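{- Let $m$ be a positive integer with $m\equiv 4\pmod 6$. Then $\Phi(m\times 4,3,1)\le J(m\times 4,3,1)-1$.
   Context: Let $I_m=\{0,1,\dots,m-1\}$ and $\mathbb{Z}_n$ the integers modulo $n$. A $2$-D $(m\times n,k,1)$-OOC is a set $\mathcal{C}$ of $k$-subsets of $I_m\times\mathbb{Z}_n$ such that $|A\cap(A+\tau)|\le 1$ for every $A\in\mathcal{C}$ and every integer $\tau\not\equiv 0\pmod n$, and $|A\cap(B+\tau)|\le 1$ for all distinct $A,B\in\mathcal{C}$ and every integer $\tau$, where $B+\tau=\{(i,x+\tau \bmod n):(i,x)\in B\}$. $\Phi(m\times n,k,1)$ denotes the largest possible number of codewords of such a code. $J(m\times n,3,1)=\left\lfloor \frac{m}{3}\left\lfloor\frac{mn-1}{2}\right\rfloor\right\rfloor$. -}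

module Defs where

open import Data.Nat using (ℕ; suc; _+_; _*_; _∸_; _≤_; NonZero)
open import Data.Nat.DivMod using (_/_; _%_; m%n<n)
open import Data.Fin using (Fin; toℕ; fromℕ<)
open import Data.Fin.Properties renaming (_≟_ to _≟ᶠ_)
open import Data.Product using (_×_; _,_)
open import Data.Product.Properties using (≡-dec)
open import Data.List using (List; length; filter; map; lookup)
open import Data.List.Relation.Unary.Unique.Propositional using (Unique)
import Data.List.Membership.DecPropositional as DecMem
open import Relation.Binary.PropositionalEquality using (_≡_)
open import Relation.Nullary using (¬_)

Point : ℕ → ℕ → Set
Point m n = Fin m × Fin n

-- A subset of I_m × ℤ_n is represented by a duplicate-free list of points.
Block : ℕ → ℕ → Set
Block m n = List (Point m n)

-- Translation of a point / block by an integer τ (taken as a natural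
-- number; every integer is congruent mod n to a natural number).
shiftPt : ∀ {m n} .{{_ : NonZero n}} → ℕ → Point m n → Point m n
shiftPt {n = n} τ (i , x) = i , fromℕ< (m%n<n (toℕ x + τ) n)

shift : ∀ {m n} .{{_ : NonZero n}} → Block m n → ℕ → Block m n
shift B τ = map (shiftPt τ) B

-- |A ∩ B|  (A is duplicate-free in all uses)
∣_∩_∣ : ∀ {m n} → Block m n → Block m n → ℕ
∣_∩_∣ {m} {n} A B = length (filter (_∈? B) A)
  where open DecMem (≡-dec (_≟ᶠ_ {m}) (_≟ᶠ_ {n})) using (_∈?_)

IsKSubset : ∀ {m n} → ℕ → Block m n → Set
IsKSubset k A = Unique A × length A ≡ k

record IsOOC (m n k : ℕ) .{{_ : NonZero n}} (C : List (Block m n)) : Set where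
  field
    ksubset : ∀ (a : Fin (length C)) → IsKSubset k (lookup C a)
    autoCorr : ∀ (a : Fin (length C)) (τ : ℕ) → ¬ (τ % n ≡ 0) →
               ∣ lookup C a ∩ shift (lookup C a) τ ∣ ≤ 1
    crossCorr : ∀ (a b : Fin (length C)) → ¬ (a ≡ b) → (τ : ℕ) →
                ∣ lookup C a ∩ shift (lookup C b) τ ∣ ≤ 1

J : ℕ → ℕ → ℕ
J m n = (m * ((m * n ∸ 1) / 2)) / 3

module Submission where

-- A codeword {p₀, p₁, p₂} yields six difference triples (row pₛ, row pₜ, column pₜ − column pₛ)
-- in I_m × I_m × ℤ₄, one for each ordered pair s ≠ t.  The correlation constraints make all
-- 6|C| of them distinct, and none has the form (i, i, d) with d = −d, since (s, t) and (t, s)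
-- would then give the same triple.  The other, admissible, triples number 4m² − 2m, which is
-- 6J + 2 when m ≡ 4 (mod 6), so |C| ≤ J.  If |C| = J, exactly two admissible triples are missed; as
-- the differences are closed under ι (i, j, d) = (j, i, −d), these are some x and ι x.  Two
-- weighted counts exclude this.  If x = (i, i, z) then z is odd: the 2m² ≡ 0 (mod 4) admissible
-- triples with odd third entry are covered four or zero at a time per codeword, yet x and ι x
-- are two of them.  If x = (i, j, z) with i ≠ j, the 4m − 2 admissible triples with first entry
-- i are covered an even number at a time, yet exactly one of x, ι x is among them.

open import Defs
open import Data.Nat using (ℕ; zero; suc; _+_; _*_; _∸_; _≤_; _<_; _%_; _/_; z≤n; s≤s; NonZero)
import Data.Nat as ℕ
open import Data.Nat.Properties
  using (+-comm; +-assoc; +-identityʳ; *-comm; *-assoc; *-zeroʳ; *-identityˡ; *-identityʳ;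
         *-distribˡ-+; +-*-semiring; +-mono-≤; +-mono-<-≤; +-mono-≤-<; +-monoˡ-≤; +-monoˡ-<;
         +-cancelˡ-<; +-cancelʳ-≡; *-cancelʳ-<; _<?_; ≤-<-trans; ≮⇒≥; <⇒≢; <⇒≱; <⇒≤; ≤∧≢⇒<;
         n≤0⇒n≡0; n<1⇒n≡0; n≢0⇒n>0; m<n+m; m<1+n⇒m≤n; <⇒≤pred; m+[n∸m]≡n)
open import Data.Nat.DivMod
  using (m%n<n; %-distribˡ-+; m%n%n≡m%n; n%n≡0; m<n⇒m%n≡m; m*n%n≡0; m≡m%n+[m/n]*n;
         +-distrib-/; m<n⇒m/n≡0; m*n/n≡m)
open import Data.Nat.Divisibility
  using (_∣_; _∣?_; divides; _∣0; ∣-trans; ∣m∣n⇒∣m+n; ∣m+n∣m⇒∣n; *-pres-∣; n∣m*n; m∣m*n)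
open import Data.Nat.Tactic.RingSolver using (solve-∀)
open import Data.Fin using (Fin; zero; suc; toℕ; fromℕ<; cast; punchIn; punchOut)
open import Data.Fin.Patterns using (0F; 1F; 2F; 3F)
import Data.Fin.Properties as Fin
open import Data.Fin.Properties
  using (toℕ-fromℕ<; toℕ-injective; fromℕ<-cong; toℕ<n; toℕ-cast; all?;
         punchInᵢ≢i; punchIn-punchOut; punchIn-injective)
open import Data.Product using (_×_; _,_; ∃; proj₁; proj₂; map)
open import Data.Product.Properties using (≡-dec)
open import Data.List using (List; []; _∷_; length; lookup)
open import Data.List.Relation.Unary.Any using (here)
open import Data.List.Relation.Unary.All.Properties using (All¬⇒¬Any)
open import Data.List.Relation.Unary.AllPairs using (_∷_)
open import Data.List.Relation.Unary.Unique.Propositional using (Unique)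
open import Data.List.Membership.Propositional using (_∈_)
open import Data.List.Membership.Propositional.Properties using (∈-filter⁺; ∈-map⁺; ∈-lookup)
import Data.List.Membership.DecPropositional as DecMembership
open import Function using (_∘_; id)
open import Relation.Binary.PropositionalEquality
  using (_≡_; _≢_; refl; sym; trans; cong; cong₂; subst; subst₂; module ≡-Reasoning)
open import Relation.Nullary using (Dec; yes; no; ¬_; ¬?; _×-dec_; contradiction)
open import Relation.Nullary.Decidable using (from-yes; from-no)
open import Algebra.Properties.Semiring.Sum +-*-semiring
  using (sum; sum-cong-≗; *-distribˡ-sum)
import Algebra.Properties.Semiring.Sum +-*-semiring as Sum

sum-const : ∀ n c → sum {n} (λ _ → c) ≡ n * c
sum-const zero c = refl
sum-const (suc n) c = cong (c +_) (sum-const n c)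

sum-zero : ∀ n {f : Fin n → ℕ} → (∀ i → f i ≡ 0) → sum f ≡ 0
sum-zero n f≗0 = trans (sum-cong-≗ f≗0) (trans (sum-const n 0) (*-zeroʳ n))

sum-mono-≤ : ∀ n {f g : Fin n → ℕ} → (∀ i → f i ≤ g i) → sum f ≤ sum g
sum-mono-≤ zero f≤g = z≤n
sum-mono-≤ (suc n) f≤g = +-mono-≤ (f≤g zero) (sum-mono-≤ n (f≤g ∘ suc))

sum-mono-< : ∀ n {f g : Fin n → ℕ} → (∀ i → f i ≤ g i) → ∀ i → f i < g i → sum f < sum g
sum-mono-< (suc n) f≤g zero f0<g0 = +-mono-<-≤ f0<g0 (sum-mono-≤ n (f≤g ∘ suc))
sum-mono-< (suc n) f≤g (suc i) fi<gi = +-mono-≤-< (f≤g zero) (sum-mono-< n (f≤g ∘ suc) i fi<gi)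

sum-<-witness : ∀ n {f g : Fin n → ℕ} → sum f < sum g → ∃ λ i → f i < g i
sum-<-witness (suc n) {f} {g} ∑f<∑g with f zero <? g zero
... | yes f0<g0 = zero , f0<g0
... | no f0≮g0 = map suc id (sum-<-witness n ∑tailf<∑tailg)
  where
  ∑tailf<∑tailg : sum (f ∘ suc) < sum (g ∘ suc)
  ∑tailf<∑tailg = +-cancelˡ-< (g zero) _ _ (≤-<-trans (+-monoˡ-≤ _ (≮⇒≥ f0≮g0)) ∑f<∑g)

sum-single : ∀ n {f : Fin n → ℕ} i → (∀ j → j ≢ i → f j ≡ 0) → sum f ≡ f i
sum-single (suc n) {f} zero off =
  trans (cong (f zero +_) (sum-zero n λ j → off (suc j) λ ())) (+-identityʳ (f zero))
sum-single (suc n) (suc i) off =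
  cong₂ _+_ (off zero λ ()) (sum-single n i λ j j≢i → off (suc j) (j≢i ∘ Fin.suc-injective))

sum-∣ : ∀ n {d} {f : Fin n → ℕ} → (∀ i → d ∣ f i) → d ∣ sum f
sum-∣ zero {d} _ = d ∣0
sum-∣ (suc n) d∣f = ∣m∣n⇒∣m+n (d∣f zero) (sum-∣ n (d∣f ∘ suc))

data Shape : Set where
  fin : ℕ → Shape
  _⊗_ : Shape → Shape → Shape

infixr 5 _⊗_

⟦_⟧ : Shape → Set
⟦ fin n ⟧ = Fin n
⟦ s ⊗ t ⟧ = ⟦ s ⟧ × ⟦ t ⟧

size : Shape → ℕ
size (fin n) = n
size (s ⊗ t) = size s * size t

∑ : (s : Shape) → (⟦ s ⟧ → ℕ) → ℕ
∑ (fin n) f = sum f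
∑ (s ⊗ t) f = ∑ s λ x → ∑ t λ y → f (x , y)

_≟_ : ∀ {s} (x y : ⟦ s ⟧) → Dec (x ≡ y)
_≟_ {fin n} = Fin._≟_
_≟_ {s ⊗ t} = ≡-dec _≟_ _≟_

𝟙[_] : ∀ {a} {A : Set a} → Dec A → ℕ
𝟙[ yes _ ] = 1
𝟙[ no _ ] = 0

𝟙-yes : ∀ {a} {A : Set a} (a? : Dec A) → A → 𝟙[ a? ] ≡ 1
𝟙-yes (yes _) _ = refl
𝟙-yes (no ¬a) a = contradiction a ¬a

𝟙-pos : ∀ {a} {A : Set a} (a? : Dec A) → 0 < 𝟙[ a? ] → A
𝟙-pos (yes a) _ = a

module _ {s : Shape} where

  𝟙-refl : (x : ⟦ s ⟧) → 𝟙[ x ≟ x ] ≡ 1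
  𝟙-refl x = 𝟙-yes (x ≟ x) refl

  𝟙-≢ : {x y : ⟦ s ⟧} → x ≢ y → 𝟙[ x ≟ y ] ≡ 0
  𝟙-≢ {x} {y} x≢y with x ≟ y
  ... | yes x≡y = contradiction x≡y x≢y
  ... | no _ = refl

∑-cong : ∀ s {f g : ⟦ s ⟧ → ℕ} → (∀ x → f x ≡ g x) → ∑ s f ≡ ∑ s g
∑-cong (fin n) f≗g = sum-cong-≗ f≗g
∑-cong (s ⊗ t) f≗g = ∑-cong s λ x → ∑-cong t λ y → f≗g (x , y)

∑-const : ∀ s c → ∑ s (λ _ → c) ≡ size s * c
∑-const (fin n) c = sum-const n c
∑-const (s ⊗ t) c = begin
  ∑ s (λ _ → ∑ t λ _ → c) ≡⟨ ∑-cong s (λ _ → ∑-const t c) ⟩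
  ∑ s (λ _ → size t * c)  ≡⟨ ∑-const s (size t * c) ⟩
  size s * (size t * c)   ≡⟨ *-assoc (size s) (size t) c ⟨
  size s * size t * c     ∎
  where open ≡-Reasoning

∑-zero : ∀ s {f : ⟦ s ⟧ → ℕ} → (∀ x → f x ≡ 0) → ∑ s f ≡ 0
∑-zero s f≗0 = trans (∑-cong s f≗0) (trans (∑-const s 0) (*-zeroʳ (size s)))

∑-distrib-+ : ∀ s (f g : ⟦ s ⟧ → ℕ) → ∑ s (λ x → f x + g x) ≡ ∑ s f + ∑ s g
∑-distrib-+ (fin n) f g = Sum.∑-distrib-+ f g
∑-distrib-+ (s ⊗ t) f g = trans (∑-cong s λ x → ∑-distrib-+ t _ _) (∑-distrib-+ s _ _)

*-distribˡ-∑ : ∀ s c (f : ⟦ s ⟧ → ℕ) → c * ∑ s f ≡ ∑ s (λ x → c * f x)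
*-distribˡ-∑ (fin n) c f = *-distribˡ-sum c f
*-distribˡ-∑ (s ⊗ t) c f = trans (*-distribˡ-∑ s c _) (∑-cong s λ x → *-distribˡ-∑ t c _)

∑-mono-≤ : ∀ s {f g : ⟦ s ⟧ → ℕ} → (∀ x → f x ≤ g x) → ∑ s f ≤ ∑ s g
∑-mono-≤ (fin n) f≤g = sum-mono-≤ n f≤g
∑-mono-≤ (s ⊗ t) f≤g = ∑-mono-≤ s λ x → ∑-mono-≤ t λ y → f≤g (x , y)

∑-mono-< : ∀ s {f g : ⟦ s ⟧ → ℕ} → (∀ x → f x ≤ g x) → ∀ x → f x < g x → ∑ s f < ∑ s g
∑-mono-< (fin n) f≤g x fx<gx = sum-mono-< n f≤g x fx<gx
∑-mono-< (s ⊗ t) f≤g (x , y) fxy<gxy =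
  ∑-mono-< s (λ x → ∑-mono-≤ t λ y → f≤g (x , y)) x (∑-mono-< t (λ y → f≤g (x , y)) y fxy<gxy)

∑-<-witness : ∀ s {f g : ⟦ s ⟧ → ℕ} → ∑ s f < ∑ s g → ∃ λ x → f x < g x
∑-<-witness (fin n) ∑f<∑g = sum-<-witness n ∑f<∑g
∑-<-witness (s ⊗ t) ∑f<∑g =
  let x , ∑fx<∑gx = ∑-<-witness s ∑f<∑g
      y , fxy<gxy = ∑-<-witness t ∑fx<∑gx
  in (x , y) , fxy<gxy

∑-single : ∀ s {f : ⟦ s ⟧ → ℕ} x → (∀ y → y ≢ x → f y ≡ 0) → ∑ s f ≡ f x
∑-single (fin n) x off = sum-single n x off
∑-single (s ⊗ t) (x , y) off =
  trans (∑-single s x λ x′ x′≢x → ∑-zero t λ y′ → off (x′ , y′) (x′≢x ∘ cong proj₁))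
        (∑-single t y λ y′ y′≢y → off (x , y′) (y′≢y ∘ cong proj₂))

∑-comm : ∀ s t (F : ⟦ s ⟧ → ⟦ t ⟧ → ℕ) → ∑ s (λ x → ∑ t (F x)) ≡ ∑ t (λ y → ∑ s λ x → F x y)
∑-comm (fin n) t F = sum-comm n F
  where
  sum-comm : ∀ n (F : Fin n → ⟦ t ⟧ → ℕ) → sum (λ i → ∑ t (F i)) ≡ ∑ t (λ y → sum λ i → F i y)
  sum-comm zero F = sym (∑-zero t λ _ → refl)
  sum-comm (suc n) F =
    trans (cong (∑ t (F zero) +_) (sum-comm n (F ∘ suc))) (sym (∑-distrib-+ t _ _))
∑-comm (s ⊗ s′) t F = trans (∑-cong s λ x → ∑-comm s′ t _) (∑-comm s t _)

∑-∣ : ∀ s {d} {f : ⟦ s ⟧ → ℕ} → (∀ x → d ∣ f x) → d ∣ ∑ s f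
∑-∣ (fin n) d∣f = sum-∣ n d∣f
∑-∣ (s ⊗ t) d∣f = ∑-∣ s λ x → ∑-∣ t λ y → d∣f (x , y)

∑-tight : ∀ s {f g : ⟦ s ⟧ → ℕ} → (∀ x → f x ≤ g x) → ∑ s f ≡ ∑ s g → ∀ x → f x ≡ g x
∑-tight s {f} {g} f≤g ∑f≡∑g x with f x ℕ.≟ g x
... | yes fx≡gx = fx≡gx
... | no fx≢gx = contradiction ∑f≡∑g (<⇒≢ (∑-mono-< s f≤g x (≤∧≢⇒< (f≤g x) fx≢gx)))

∑-select : ∀ s (w : ⟦ s ⟧ → ℕ) x → ∑ s (λ y → w y * 𝟙[ x ≟ y ]) ≡ w x
∑-select s w x = trans (∑-single s x off) (trans (cong (w x *_) (𝟙-refl x)) (*-identityʳ (w x)))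
  where
  off : ∀ y → y ≢ x → w y * 𝟙[ x ≟ y ] ≡ 0
  off y y≢x = trans (cong (w y *_) (𝟙-≢ (y≢x ∘ sym))) (*-zeroʳ (w y))

∑-𝟙 : ∀ s (x : ⟦ s ⟧) → ∑ s (λ y → 𝟙[ x ≟ y ]) ≡ 1
∑-𝟙 s x = trans (∑-cong s λ y → sym (*-identityˡ _)) (∑-select s (λ _ → 1) x)

module _ {s t : Shape} (f : ⟦ s ⟧ → ⟦ t ⟧) where

  count : ⟦ t ⟧ → ℕ
  count y = ∑ s λ x → 𝟙[ f x ≟ y ]

  ∑[w∘f]≡∑[w*count] : ∀ w → ∑ s (w ∘ f) ≡ ∑ t (λ y → w y * count y)
  ∑[w∘f]≡∑[w*count] w = sym (begin
    ∑ t (λ y → w y * count y)                 ≡⟨ ∑-cong t (λ y → *-distribˡ-∑ s (w y) _) ⟩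
    ∑ t (λ y → ∑ s λ x → w y * 𝟙[ f x ≟ y ])  ≡⟨ ∑-comm t s _ ⟩
    ∑ s (λ x → ∑ t λ y → w y * 𝟙[ f x ≟ y ])  ≡⟨ ∑-cong s (λ x → ∑-select t w (f x)) ⟩
    ∑ s (w ∘ f)                               ∎)
    where open ≡-Reasoning

  count-pos : ∀ x → 0 < count (f x)
  count-pos x = subst (_< count (f x)) (∑-zero s λ _ → refl)
    (∑-mono-< s (λ _ → z≤n) x (subst (0 <_) (sym (𝟙-refl (f x))) (s≤s z≤n)))

  count-image : ∀ {y} → 0 < count y → ∃ λ x → f x ≡ y
  count-image {y} 0<count = map id (λ {x} → 𝟙-pos (f x ≟ y))
    (∑-<-witness s (subst (_< count y) (sym (∑-zero s λ _ → refl)) 0<count))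

  count-≤-𝟙 : ∀ {p} {P : ⟦ t ⟧ → Set p} (P? : ∀ y → Dec (P y)) → (∀ x → P (f x)) →
              (∀ x x′ → f x ≡ f x′ → x ≡ x′) → ∀ y → count y ≤ 𝟙[ P? y ]
  count-≤-𝟙 {P = P} P? P∘f f-inj y with P? y
  ... | no ¬Py = ≮⇒≥ λ 0<count → let x , fx≡y = count-image 0<count in ¬Py (subst P fx≡y (P∘f x))
  ... | yes _ with count y ℕ.≟ 0
  ...   | yes count≡0 = subst (_≤ 1) (sym count≡0) z≤n
  ...   | no count≢0 = subst (_≤ 1) (sym count≡1) (s≤s z≤n)
    where
    count≡1 : count y ≡ 1
    count≡1 = let x , fx≡y = count-image (n≢0⇒n>0 count≢0) in
      trans (∑-single s x λ x′ x′≢x → 𝟙-≢ λ fx′≡y → x′≢x (f-inj x′ x (trans fx′≡y (sym fx≡y))))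
            (trans (cong (λ z → 𝟙[ f x ≟ z ]) (sym fx≡y)) (𝟙-refl (f x)))

two-point-deficit : ∀ s (c v : ⟦ s ⟧ → ℕ) (ι : ⟦ s ⟧ → ⟦ s ⟧) →
  (∀ x → c x ≤ v x) → ∑ s v ≡ 2 + ∑ s c →
  (∀ x → c x < v x → c (ι x) < v (ι x) × ι x ≢ x) →
  ∃ λ x → c x < v x × ∀ w → ∑ s (λ y → w y * v y) ≡ w x + (w (ι x) + ∑ s λ y → w y * c y)
two-point-deficit s c v ι c≤v ∑v≡2+∑c deficit-closed = x , cx<vx , weighted
  where
  open ≡-Reasoning
  x,cx<vx : ∃ λ x → c x < v x
  x,cx<vx = ∑-<-witness s (subst (∑ s c <_) (sym ∑v≡2+∑c) (m<n+m (∑ s c) (s≤s z≤n)))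
  x : ⟦ s ⟧
  x = proj₁ x,cx<vx
  cx<vx : c x < v x
  cx<vx = proj₂ x,cx<vx
  cιx<vιx : c (ι x) < v (ι x)
  cιx<vιx = proj₁ (deficit-closed x cx<vx)
  ιx≢x : ι x ≢ x
  ιx≢x = proj₂ (deficit-closed x cx<vx)

  g : ⟦ s ⟧ → ℕ
  g y = 𝟙[ x ≟ y ] + (𝟙[ ι x ≟ y ] + c y)

  g≤v : ∀ y → g y ≤ v y
  g≤v y with x ≟ y | ι x ≟ y
  ... | yes refl | yes ιx≡x = contradiction ιx≡x ιx≢x
  ... | yes refl | no _ = cx<vx
  ... | no _ | yes refl = cιx<vιx
  ... | no _ | no _ = c≤v y

  g≡v : ∀ y → g y ≡ v y
  g≡v = ∑-tight s g≤v (begin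
    ∑ s g
      ≡⟨ ∑-distrib-+ s _ _ ⟩
    ∑ s (λ y → 𝟙[ x ≟ y ]) + ∑ s (λ y → 𝟙[ ι x ≟ y ] + c y)
      ≡⟨ cong₂ _+_ (∑-𝟙 s x) (trans (∑-distrib-+ s _ _) (cong (_+ ∑ s c) (∑-𝟙 s (ι x)))) ⟩
    2 + ∑ s c
      ≡⟨ ∑v≡2+∑c ⟨
    ∑ s v
      ∎)

  weighted : ∀ w → ∑ s (λ y → w y * v y) ≡ w x + (w (ι x) + ∑ s λ y → w y * c y)
  weighted w = begin
    ∑ s (λ y → w y * v y)
      ≡⟨ ∑-cong s (λ y → cong (w y *_) (sym (g≡v y))) ⟩
    ∑ s (λ y → w y * g y)
      ≡⟨ ∑-cong s distrib ⟩
    ∑ s (λ y → w y * 𝟙[ x ≟ y ] + (w y * 𝟙[ ι x ≟ y ] + w y * c y))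
      ≡⟨ trans (∑-distrib-+ s _ _) (cong (∑ s (λ y → w y * 𝟙[ x ≟ y ]) +_) (∑-distrib-+ s _ _)) ⟩
    ∑ s (λ y → w y * 𝟙[ x ≟ y ]) + (∑ s (λ y → w y * 𝟙[ ι x ≟ y ]) + ∑ s (λ y → w y * c y))
      ≡⟨ cong₂ _+_ (∑-select s w x) (cong (_+ _) (∑-select s w (ι x))) ⟩
    w x + (w (ι x) + ∑ s λ y → w y * c y)
      ∎
    where
    distrib : ∀ y → w y * g y ≡ w y * 𝟙[ x ≟ y ] + (w y * 𝟙[ ι x ≟ y ] + w y * c y)
    distrib y = trans (*-distribˡ-+ (w y) _ _) (cong (w y * 𝟙[ x ≟ y ] +_) (*-distribˡ-+ (w y) _ _))

[m%d+n]%d≡[m+n]%d : ∀ m n d .{{_ : NonZero d}} → (m % d + n) % d ≡ (m + n) % d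
[m%d+n]%d≡[m+n]%d m n d = begin
  (m % d + n) % d          ≡⟨ %-distribˡ-+ (m % d) n d ⟩
  (m % d % d + n % d) % d  ≡⟨ cong (λ u → (u + n % d) % d) (m%n%n≡m%n m d) ⟩
  (m % d + n % d) % d      ≡⟨ %-distribˡ-+ m n d ⟨
  (m + n) % d              ∎
  where open ≡-Reasoning

[m+n%d]%d≡[m+n]%d : ∀ m n d .{{_ : NonZero d}} → (m + n % d) % d ≡ (m + n) % d
[m+n%d]%d≡[m+n]%d m n d = begin
  (m + n % d) % d  ≡⟨ cong (_% d) (+-comm m (n % d)) ⟩
  (n % d + m) % d  ≡⟨ [m%d+n]%d≡[m+n]%d n m d ⟩
  (n + m) % d      ≡⟨ cong (_% d) (+-comm n m) ⟩
  (m + n) % d      ∎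
  where open ≡-Reasoning

module _ {n : ℕ} where

  infixl 6 _⊕_ _⊖_
  infix 8 ⊝_

  -- The column part of shiftPt τ, so that shiftPt τ (i , x) reduces to (i , x ⊕ τ).
  _⊕_ : Fin (suc n) → ℕ → Fin (suc n)
  x ⊕ τ = fromℕ< (m%n<n (toℕ x + τ) (suc n))

  _⊖_ : Fin (suc n) → Fin (suc n) → Fin (suc n)
  y ⊖ x = y ⊕ (suc n ∸ toℕ x)

  ⊝_ : Fin (suc n) → Fin (suc n)
  ⊝ x = zero ⊖ x

  toℕ-⊕ : ∀ x τ → toℕ (x ⊕ τ) ≡ (toℕ x + τ) % suc n
  toℕ-⊕ x τ = toℕ-fromℕ< _

  ⊕-cong-% : ∀ x τ y σ → (toℕ x + τ) % suc n ≡ (toℕ y + σ) % suc n → x ⊕ τ ≡ y ⊕ σ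
  ⊕-cong-% x τ y σ eq = fromℕ<-cong _ _ eq _ _

  ⊕-+ : ∀ x τ σ → x ⊕ τ ⊕ σ ≡ x ⊕ (τ + σ)
  ⊕-+ x τ σ = ⊕-cong-% (x ⊕ τ) σ x (τ + σ) (begin
    (toℕ (x ⊕ τ) + σ) % suc n          ≡⟨ cong (λ u → (u + σ) % suc n) (toℕ-⊕ x τ) ⟩
    ((toℕ x + τ) % suc n + σ) % suc n  ≡⟨ [m%d+n]%d≡[m+n]%d (toℕ x + τ) σ (suc n) ⟩
    (toℕ x + τ + σ) % suc n            ≡⟨ cong (_% suc n) (+-assoc (toℕ x) τ σ) ⟩
    (toℕ x + (τ + σ)) % suc n          ∎)
    where open ≡-Reasoning

  ⊕-comm : ∀ x y → x ⊕ toℕ y ≡ y ⊕ toℕ x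
  ⊕-comm x y = ⊕-cong-% x (toℕ y) y (toℕ x) (cong (_% suc n) (+-comm (toℕ x) (toℕ y)))

  ⊕-toℕ-⊕ : ∀ x y σ → x ⊕ toℕ (y ⊕ σ) ≡ x ⊕ toℕ y ⊕ σ
  ⊕-toℕ-⊕ x y σ = ⊕-cong-% x (toℕ (y ⊕ σ)) (x ⊕ toℕ y) σ (begin
    (toℕ x + toℕ (y ⊕ σ)) % suc n          ≡⟨ cong (λ u → (toℕ x + u) % suc n) (toℕ-⊕ y σ) ⟩
    (toℕ x + (toℕ y + σ) % suc n) % suc n  ≡⟨ [m+n%d]%d≡[m+n]%d (toℕ x) (toℕ y + σ) (suc n) ⟩
    (toℕ x + (toℕ y + σ)) % suc n          ≡⟨ cong (_% suc n) (+-assoc (toℕ x) (toℕ y) σ) ⟨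
    (toℕ x + toℕ y + σ) % suc n            ≡⟨ [m%d+n]%d≡[m+n]%d (toℕ x + toℕ y) σ (suc n) ⟨
    ((toℕ x + toℕ y) % suc n + σ) % suc n  ≡⟨ cong (λ u → (u + σ) % suc n) (toℕ-⊕ x (toℕ y)) ⟨
    (toℕ (x ⊕ toℕ y) + σ) % suc n          ∎)
    where open ≡-Reasoning

  ⊕-multiple : ∀ x τ → τ % suc n ≡ 0 → x ⊕ τ ≡ x
  ⊕-multiple x τ τ%n≡0 = toℕ-injective (begin
    toℕ (x ⊕ τ)                  ≡⟨ toℕ-⊕ x τ ⟩
    (toℕ x + τ) % suc n          ≡⟨ [m+n%d]%d≡[m+n]%d (toℕ x) τ (suc n) ⟨
    (toℕ x + τ % suc n) % suc n  ≡⟨ cong (λ u → (toℕ x + u) % suc n) τ%n≡0 ⟩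
    (toℕ x + 0) % suc n          ≡⟨ cong (_% suc n) (+-identityʳ (toℕ x)) ⟩
    toℕ x % suc n                ≡⟨ m<n⇒m%n≡m (toℕ<n x) ⟩
    toℕ x                        ∎)
    where open ≡-Reasoning

  ⊕-full-turn : ∀ (x y : Fin (suc n)) → y ⊕ (toℕ x + (suc n ∸ toℕ x)) ≡ y
  ⊕-full-turn x y =
    ⊕-multiple y _ (trans (cong (_% suc n) (m+[n∸m]≡n (<⇒≤ (toℕ<n x)))) (n%n≡0 (suc n)))

  ⊕-⊖ : ∀ x y → x ⊕ toℕ (y ⊖ x) ≡ y
  ⊕-⊖ x y = begin
    x ⊕ toℕ (y ⊖ x)                ≡⟨ ⊕-toℕ-⊕ x y _ ⟩
    x ⊕ toℕ y ⊕ (suc n ∸ toℕ x)    ≡⟨ cong (_⊕ (suc n ∸ toℕ x)) (⊕-comm x y) ⟩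
    y ⊕ toℕ x ⊕ (suc n ∸ toℕ x)    ≡⟨ ⊕-+ y _ _ ⟩
    y ⊕ (toℕ x + (suc n ∸ toℕ x))  ≡⟨ ⊕-full-turn x y ⟩
    y                              ∎
    where open ≡-Reasoning

  ⊖-⊕ : ∀ x y → y ⊕ toℕ x ⊖ x ≡ y
  ⊖-⊕ x y = trans (⊕-+ y _ _) (⊕-full-turn x y)

  ⊖-self : ∀ x → x ⊖ x ≡ zero
  ⊖-self x = toℕ-injective (begin
    toℕ (x ⊖ x)                        ≡⟨ toℕ-⊕ x _ ⟩
    (toℕ x + (suc n ∸ toℕ x)) % suc n  ≡⟨ cong (_% suc n) (m+[n∸m]≡n (<⇒≤ (toℕ<n x))) ⟩
    suc n % suc n                      ≡⟨ n%n≡0 (suc n) ⟩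
    0                                  ∎)
    where open ≡-Reasoning

  ⊕-cancelˡ : ∀ x {d d′} → x ⊕ toℕ d ≡ x ⊕ toℕ d′ → d ≡ d′
  ⊕-cancelˡ x {d} {d′} eq = begin
    d               ≡⟨ ⊖-⊕ x d ⟨
    d ⊕ toℕ x ⊖ x   ≡⟨ cong (_⊖ x) (⊕-comm d x) ⟩
    x ⊕ toℕ d ⊖ x   ≡⟨ cong (_⊖ x) eq ⟩
    x ⊕ toℕ d′ ⊖ x  ≡⟨ cong (_⊖ x) (⊕-comm x d′) ⟩
    d′ ⊕ toℕ x ⊖ x  ≡⟨ ⊖-⊕ x d′ ⟩
    d′              ∎
    where open ≡-Reasoning

  ⊖-translate : ∀ x y x′ y′ → y ⊖ x ≡ y′ ⊖ x′ → y′ ⊕ toℕ (x ⊖ x′) ≡ y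
  ⊖-translate x y x′ y′ eq = begin
    y′ ⊕ toℕ (x ⊖ x′)              ≡⟨ ⊕-toℕ-⊕ y′ x _ ⟩
    y′ ⊕ toℕ x ⊕ (suc n ∸ toℕ x′)  ≡⟨ cong (_⊕ (suc n ∸ toℕ x′)) (⊕-comm y′ x) ⟩
    x ⊕ toℕ y′ ⊕ (suc n ∸ toℕ x′)  ≡⟨ ⊕-toℕ-⊕ x y′ _ ⟨
    x ⊕ toℕ (y′ ⊖ x′)              ≡⟨ cong (λ d → x ⊕ toℕ d) eq ⟨
    x ⊕ toℕ (y ⊖ x)                ≡⟨ ⊕-⊖ x y ⟩
    y                              ∎
    where open ≡-Reasoning

  ⊖-anticomm : ∀ x y → y ⊖ x ≡ ⊝ (x ⊖ y)
  ⊖-anticomm x y = ⊕-cancelˡ (x ⊖ y) (begin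
    x ⊖ y ⊕ toℕ (y ⊖ x)                ≡⟨ ⊕-comm (x ⊖ y) (y ⊖ x) ⟩
    y ⊖ x ⊕ toℕ (x ⊖ y)                ≡⟨ ⊕-toℕ-⊕ (y ⊖ x) x _ ⟩
    y ⊖ x ⊕ toℕ x ⊕ (suc n ∸ toℕ y)    ≡⟨ cong (_⊕ (suc n ∸ toℕ y)) (⊕-comm (y ⊖ x) x) ⟩
    x ⊕ toℕ (y ⊖ x) ⊕ (suc n ∸ toℕ y)  ≡⟨ cong (_⊕ (suc n ∸ toℕ y)) (⊕-⊖ x y) ⟩
    y ⊖ y                              ≡⟨ ⊖-self y ⟩
    zero                               ≡⟨ ⊕-⊖ (x ⊖ y) zero ⟨
    x ⊖ y ⊕ toℕ (⊝ (x ⊖ y))            ∎)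
    where open ≡-Reasoning

  ⊝-involutive : ∀ x → ⊝ ⊝ x ≡ x
  ⊝-involutive x = trans (sym (⊖-anticomm zero x)) (⊕-multiple x _ (n%n≡0 (suc n)))

lookup-injective : ∀ {A : Set} {xs : List A} → Unique xs → ∀ i j → lookup xs i ≡ lookup xs j → i ≡ j
lookup-injective {xs = x ∷ xs} _ zero zero _ = refl
lookup-injective {xs = x ∷ xs} (x∉xs ∷ _) zero (suc j) x≡xsⱼ =
  contradiction (subst (_∈ xs) (sym x≡xsⱼ) (∈-lookup j)) (All¬⇒¬Any x∉xs)
lookup-injective {xs = x ∷ xs} (x∉xs ∷ _) (suc i) zero xsᵢ≡x =
  contradiction (subst (_∈ xs) xsᵢ≡x (∈-lookup i)) (All¬⇒¬Any x∉xs)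
lookup-injective {xs = x ∷ xs} (_ ∷ unique) (suc i) (suc j) eq = cong suc (lookup-injective unique i j eq)

2≤length : ∀ {A : Set} {x y : A} {xs : List A} → x ≢ y → x ∈ xs → y ∈ xs → 2 ≤ length xs
2≤length {xs = _ ∷ _ ∷ _} _ _ _ = s≤s (s≤s z≤n)
2≤length {xs = _ ∷ []} x≢y (here refl) (here refl) = contradiction refl x≢y

module _ {m n : ℕ} where
  open DecMembership (≡-dec (Fin._≟_ {m}) (Fin._≟_ {n})) using (_∈?_)

  2≤∣∩∣ : ∀ {A B : Block m n} {p q} → p ≢ q → p ∈ A → q ∈ A → p ∈ B → q ∈ B → 2 ≤ ∣ A ∩ B ∣
  2≤∣∩∣ {B = B} p≢q p∈A q∈A p∈B q∈B =
    2≤length p≢q (∈-filter⁺ (_∈? B) p∈A p∈B) (∈-filter⁺ (_∈? B) q∈A q∈B)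

Triple : ℕ → ℕ → Set
Triple m n = Fin m × Fin m × Fin n

module _ {m n : ℕ} where

  Δ : Point m (suc n) → Point m (suc n) → Triple m (suc n)
  Δ (i , x) (j , y) = i , j , y ⊖ x

  ι : Triple m (suc n) → Triple m (suc n)
  ι (i , j , d) = j , i , ⊝ d

  ι-involutive : ∀ t → ι (ι t) ≡ t
  ι-involutive (i , j , d) = cong (λ d → i , j , d) (⊝-involutive d)

  Δ-swap : ∀ p q → Δ q p ≡ ι (Δ p q)
  Δ-swap (i , x) (j , y) = cong (λ d → j , i , d) (⊖-anticomm y x)

  Δ-translate : ∀ p q p′ q′ → Δ p q ≡ Δ p′ q′ → ∃ λ τ → shiftPt τ p′ ≡ p × shiftPt τ q′ ≡ q
  Δ-translate (i , x) (j , y) (i′ , x′) (j′ , y′) eq =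
    toℕ (x ⊖ x′) , cong₂ _,_ (sym (cong proj₁ eq)) (⊕-⊖ x′ x)
                 , cong₂ _,_ (sym (cong (proj₁ ∘ proj₂) eq))
                             (⊖-translate x y x′ y′ (cong (proj₂ ∘ proj₂) eq))

  shiftPt-multiple : ∀ τ (p : Point m (suc n)) → τ % suc n ≡ 0 → shiftPt τ p ≡ p
  shiftPt-multiple τ (i , x) τ%n≡0 = cong (i ,_) (⊕-multiple x τ τ%n≡0)

  Admissible : Triple m (suc n) → Set
  Admissible (i , j , d) = ¬ (i ≡ j × d ≡ ⊝ d)

  admissible? : ∀ t → Dec (Admissible t)
  admissible? (i , j , d) = ¬? ((i Fin.≟ j) ×-dec (d Fin.≟ ⊝ d))

  ι-admissible : ∀ {t} → Admissible t → Admissible (ι t)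
  ι-admissible {i , j , d} adm (j≡i , ⊝d≡⊝⊝d) =
    adm (sym j≡i , trans (sym (⊝-involutive d)) (sym ⊝d≡⊝⊝d))

  admissible⇒ι-moves : ∀ {t} → Admissible t → ι t ≢ t
  admissible⇒ι-moves adm ιt≡t = adm (sym (cong proj₁ ιt≡t) , sym (cong (proj₂ ∘ proj₂) ιt≡t))

  inadmissible⇒ι-fixes : ∀ {t} → ¬ Admissible t → ι t ≡ t
  inadmissible⇒ι-fixes {i , j , d} ¬adm with i Fin.≟ j | d Fin.≟ ⊝ d
  ... | yes refl | yes d≡⊝d = cong (λ d → i , i , d) (sym d≡⊝d)
  ... | no i≢j | _ = contradiction (λ (i≡j , _) → i≢j i≡j) ¬adm
  ... | _ | no d≢⊝d = contradiction (λ (_ , d≡⊝d) → d≢⊝d d≡⊝d) ¬adm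

#admissible : ℕ → ℕ → ℕ
#admissible m zero = 0
#admissible m (suc n) = ∑ (fin m ⊗ fin m ⊗ fin (suc n)) λ t → 𝟙[ admissible? t ]

-- An ordered pair (s , t) of distinct indices is encoded as (s , r) with t = punchIn s r.
Pair : ℕ → Set
Pair w = Fin (suc w) × Fin w

module _ {w : ℕ} where

  first second : Pair w → Fin (suc w)
  first (s , r) = s
  second (s , r) = punchIn s r

  swap : Pair w → Pair w
  swap (s , r) = punchIn s r , punchOut (punchInᵢ≢i s r)

  second≢first : ∀ k → second k ≢ first k
  second≢first (s , r) = punchInᵢ≢i s r

  second-swap : ∀ k → second (swap k) ≡ first k
  second-swap (s , r) = punchIn-punchOut (punchInᵢ≢i s r)

  pair-injective : ∀ {k k′} → first k ≡ first k′ → second k ≡ second k′ → k ≡ k′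
  pair-injective {s , r} {.s , r′} refl eq = cong (s ,_) (punchIn-injective s r r′ eq)

module Differences {m n w : ℕ} {C : List (Block m (suc n))} (ooc : IsOOC m (suc n) (suc w) C) where
  open IsOOC ooc

  Codeword : Set
  Codeword = Fin (length C)

  point : Codeword → Fin (suc w) → Point m (suc n)
  point a s = lookup (lookup C a) (cast (sym (proj₂ (ksubset a))) s)

  point-∈ : ∀ a s → point a s ∈ lookup C a
  point-∈ a s = ∈-lookup _

  point-injective : ∀ a {s s′} → point a s ≡ point a s′ → s ≡ s′
  point-injective a {s} {s′} eq = toℕ-injective (begin
    toℕ s           ≡⟨ toℕ-cast _ s ⟨
    toℕ (cast _ s)  ≡⟨ cong toℕ (lookup-injective (proj₁ (ksubset a)) _ _ eq) ⟩
    toℕ (cast _ s′) ≡⟨ toℕ-cast _ s′ ⟩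
    toℕ s′          ∎)
    where open ≡-Reasoning

  large-overlap⇒same-codeword : ∀ a b τ → 2 ≤ ∣ lookup C a ∩ shift (lookup C b) τ ∣ →
                                a ≡ b × τ % suc n ≡ 0
  large-overlap⇒same-codeword a b τ 2≤∣∩∣ with a Fin.≟ b | τ % suc n ℕ.≟ 0
  ... | no a≢b | _ = contradiction (crossCorr a b a≢b τ) (<⇒≱ 2≤∣∩∣)
  ... | yes refl | no τ≢0 = contradiction (autoCorr a τ τ≢0) (<⇒≱ 2≤∣∩∣)
  ... | yes refl | yes τ≡0 = refl , τ≡0

  translates⇒same-codeword : ∀ a b τ {s t s′ t′} → s ≢ t →
    shiftPt τ (point b s′) ≡ point a s → shiftPt τ (point b t′) ≡ point a t → a ≡ b × τ % suc n ≡ 0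
  translates⇒same-codeword a b τ s≢t s′↦s t′↦t = large-overlap⇒same-codeword a b τ
    (2≤∣∩∣ (s≢t ∘ point-injective a) (point-∈ a _) (point-∈ a _) (shifted-∈ s′↦s) (shifted-∈ t′↦t))
    where
    shifted-∈ : ∀ {s s′} → shiftPt τ (point b s′) ≡ point a s → point a s ∈ shift (lookup C b) τ
    shifted-∈ {s} {s′} eq = subst (_∈ shift (lookup C b) τ) eq (∈-map⁺ (shiftPt τ) (point-∈ b s′))

  I T : Shape
  I = fin (length C) ⊗ fin (suc w) ⊗ fin w
  T = fin m ⊗ fin m ⊗ fin (suc n)

  difference : ⟦ I ⟧ → ⟦ T ⟧
  difference (a , k) = Δ (point a (first k)) (point a (second k))

  difference-injective : ∀ x y → difference x ≡ difference y → x ≡ y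
  difference-injective (a , k) (b , k′) eq
    with τ , p′↦p , q′↦q ← Δ-translate (point a (first k)) (point a (second k))
                                        (point b (first k′)) (point b (second k′)) eq
    with refl , τ≡0 ← translates⇒same-codeword a b τ (second≢first k ∘ sym) p′↦p q′↦q
    = cong (a ,_) (pair-injective
        (point-injective a (trans (sym p′↦p) (shiftPt-multiple τ (point a (first k′)) τ≡0)))
        (point-injective a (trans (sym q′↦q) (shiftPt-multiple τ (point a (second k′)) τ≡0))))

  difference-swap : ∀ a k → difference (a , swap k) ≡ ι (difference (a , k))
  difference-swap a k = trans (cong (Δ (point a (second k)) ∘ point a) (second-swap k))
                              (Δ-swap (point a (first k)) (point a (second k)))

  difference-admissible : ∀ x → Admissible (difference x)
  difference-admissible (a , k) ¬adm = second≢first k (cong proj₁ swap-k≡k)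
    where
    swap-k≡k : swap k ≡ k
    swap-k≡k = cong proj₂ (difference-injective (a , swap k) (a , k)
                 (trans (difference-swap a k) (inadmissible⇒ι-fixes (λ adm → adm ¬adm))))

  covered≤admissible : ∀ t → count difference t ≤ 𝟙[ admissible? t ]
  covered≤admissible = count-≤-𝟙 difference admissible? difference-admissible difference-injective

  ∑-covered : ∑ T (count difference) ≡ length C * (suc w * w)
  ∑-covered = begin
    ∑ T (count difference)              ≡⟨ ∑-cong T {λ t → 1 * count difference t}
                                             (λ t → *-identityˡ (count difference t)) ⟨
    ∑ T (λ t → 1 * count difference t)  ≡⟨ ∑[w∘f]≡∑[w*count] difference (λ _ → 1) ⟨
    ∑ I (λ _ → 1)                       ≡⟨ ∑-const I 1 ⟩
    size I * 1                          ≡⟨ *-identityʳ _ ⟩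
    length C * (suc w * w)              ∎
    where open ≡-Reasoning

  differences-fit : length C * (suc w * w) ≤ #admissible m (suc n)
  differences-fit = subst (_≤ #admissible m (suc n)) ∑-covered (∑-mono-≤ T covered≤admissible)

  uncovered-ι : ∀ t → count difference t ≡ 0 → count difference (ι t) ≡ 0
  uncovered-ι t t-uncovered = n≤0⇒n≡0 (≮⇒≥ λ ιt-covered →
    let (a , k) , δ≡ιt = count-image difference ιt-covered
        δ-swap≡t = trans (difference-swap a k) (trans (cong ι δ≡ιt) (ι-involutive t))
    in <⇒≢ (subst (λ u → 0 < count difference u) δ-swap≡t (count-pos difference (a , swap k)))
           (sym t-uncovered))

  deficit-closed : ∀ t → count difference t < 𝟙[ admissible? t ] →
                   count difference (ι t) < 𝟙[ admissible? (ι t) ] × ι t ≢ t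
  deficit-closed t deficit = ιt-deficit , admissible⇒ι-moves adm
    where
    adm : Admissible t
    adm = 𝟙-pos (admissible? t) (≤-<-trans z≤n deficit)
    t-uncovered : count difference t ≡ 0
    t-uncovered = n<1⇒n≡0 (subst (count difference t <_) (𝟙-yes (admissible? t) adm) deficit)
    ιt-deficit : count difference (ι t) < 𝟙[ admissible? (ι t) ]
    ιt-deficit = subst₂ _<_ (sym (uncovered-ι t t-uncovered))
                            (sym (𝟙-yes (admissible? (ι t)) (ι-admissible adm))) (s≤s z≤n)

isOdd : Fin 4 → ℕ
isOdd d = toℕ d % 2

isOdd+isOdd[⊝d]≡2 : ∀ d → d ≢ ⊝ d → isOdd d + isOdd (⊝ d) ≡ 2
isOdd+isOdd[⊝d]≡2 0F 0≢⊝0 = contradiction refl 0≢⊝0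
isOdd+isOdd[⊝d]≡2 1F _ = refl
isOdd+isOdd[⊝d]≡2 2F 2≢⊝2 = contradiction refl 2≢⊝2
isOdd+isOdd[⊝d]≡2 3F _ = refl

oddGaps : (Fin 3 → Fin 4) → ℕ
oddGaps c = ∑ (fin 3 ⊗ fin 2) λ k → isOdd (c (second k) ⊖ c (first k))

-- An even number of the three unordered pairs have an odd gap; checked on all 4³ column choices.
4∣oddGaps : ∀ c → 4 ∣ oddGaps c
4∣oddGaps c =
  from-yes (all? λ x → all? λ y → all? λ z → 4 ∣? oddGaps λ { 0F → x ; 1F → y ; 2F → z })
    (c 0F) (c 1F) (c 2F)

∑-admissible-gaps : ∀ {A : Set} (i≟j : Dec A) →
  ∑ (fin 4) (λ d → 𝟙[ ¬? (i≟j ×-dec (d Fin.≟ ⊝ d)) ]) + 2 * 𝟙[ i≟j ] ≡ 4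
∑-admissible-gaps (yes _) = refl
∑-admissible-gaps (no _) = refl

∑-odd-admissible-gaps : ∀ {A : Set} (i≟j : Dec A) →
  ∑ (fin 4) (λ d → isOdd d * 𝟙[ ¬? (i≟j ×-dec (d Fin.≟ ⊝ d)) ]) ≡ 2
∑-odd-admissible-gaps (yes _) = refl
∑-odd-admissible-gaps (no _) = refl

∑-admissible-row : ∀ {m} (i : Fin m) →
  ∑ (fin m ⊗ fin 4) (λ (j , d) → 𝟙[ admissible? (i , j , d) ]) + 2 ≡ m * 4
∑-admissible-row {m} i = begin
  ∑ (fin m) V + 2
    ≡⟨ cong (λ u → ∑ (fin m) V + 2 * u) (∑-𝟙 (fin m) i) ⟨
  ∑ (fin m) V + 2 * ∑ (fin m) (λ j → 𝟙[ i ≟ j ])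
    ≡⟨ cong (∑ (fin m) V +_) (*-distribˡ-∑ (fin m) 2 _) ⟩
  ∑ (fin m) V + ∑ (fin m) (λ j → 2 * 𝟙[ i ≟ j ])
    ≡⟨ ∑-distrib-+ (fin m) _ _ ⟨
  ∑ (fin m) (λ j → V j + 2 * 𝟙[ i ≟ j ])
    ≡⟨ ∑-cong (fin m) (λ j → ∑-admissible-gaps (i ≟ j)) ⟩
  ∑ (fin m) (λ _ → 4)
    ≡⟨ ∑-const (fin m) 4 ⟩
  m * 4
    ∎
  where
  open ≡-Reasoning
  V : Fin m → ℕ
  V j = ∑ (fin 4) λ d → 𝟙[ admissible? (i , j , d) ]

#admissible[m,4]+2m≡4m² : ∀ m → #admissible m 4 + m * 2 ≡ m * (m * 4)
#admissible[m,4]+2m≡4m² m = begin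
  ∑ (fin m) R + m * 2                ≡⟨ cong (∑ (fin m) R +_) (∑-const (fin m) 2) ⟨
  ∑ (fin m) R + ∑ (fin m) (λ _ → 2)  ≡⟨ ∑-distrib-+ (fin m) _ _ ⟨
  ∑ (fin m) (λ i → R i + 2)          ≡⟨ ∑-cong (fin m) ∑-admissible-row ⟩
  ∑ (fin m) (λ _ → m * 4)            ≡⟨ ∑-const (fin m) (m * 4) ⟩
  m * (m * 4)                        ∎
  where
  open ≡-Reasoning
  R : Fin m → ℕ
  R i = ∑ (fin m ⊗ fin 4) λ (j , d) → 𝟙[ admissible? (i , j , d) ]

∑-odd-admissible≡2m² : ∀ m →
  ∑ (fin m ⊗ fin m ⊗ fin 4) (λ (i , j , d) → isOdd d * 𝟙[ admissible? (i , j , d) ]) ≡ m * (m * 2)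
∑-odd-admissible≡2m² m =
  trans (∑-cong (fin m) λ i →
           trans (∑-cong (fin m) λ j → ∑-odd-admissible-gaps (i ≟ j)) (∑-const (fin m) 2))
        (∑-const (fin m) (m * 2))

module Leaves {m : ℕ} {C : List (Block m 4)} (ooc : IsOOC m 4 3 C) where
  open Differences ooc

  -- x and ι x are exactly the admissible triples that are not differences.
  Leave : Triple m 4 → Set
  Leave x = ∀ w → ∑ T (λ y → w y * 𝟙[ admissible? y ]) ≡ w x + (w (ι x) + ∑ I (w ∘ difference))

  leave-exists : #admissible m 4 ≡ 2 + length C * 6 → ∃ λ x → Admissible x × Leave x
  leave-exists #adm≡2+6N =
    let x , deficit , weighted =
          two-point-deficit T (count difference) (λ y → 𝟙[ admissible? y ]) ι covered≤admissible
            (trans #adm≡2+6N (cong (2 +_) (sym ∑-covered))) deficit-closed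
    in x , 𝟙-pos (admissible? x) (≤-<-trans z≤n deficit)
         , λ w → trans (weighted w)
                       (cong (λ u → w x + (w (ι x) + u)) (sym (∑[w∘f]≡∑[w*count] difference w)))

  pure-leave-impossible : 2 ∣ m → ∀ i z → Admissible (i , i , z) → ¬ Leave (i , i , z)
  pure-leave-impossible 2∣m i z adm leave = from-no (4 ∣? 2) 4∣2
    where
    w : Triple m 4 → ℕ
    w (_ , _ , d) = isOdd d
    D : ℕ
    D = ∑ I (w ∘ difference)
    4∣D : 4 ∣ D
    4∣D = ∑-∣ (fin (length C)) λ a → 4∣oddGaps (proj₂ ∘ point a)
    2m²≡2+D : m * (m * 2) ≡ 2 + D
    2m²≡2+D = begin
      m * (m * 2)                           ≡⟨ ∑-odd-admissible≡2m² m ⟨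
      ∑ T (λ y → w y * 𝟙[ admissible? y ])  ≡⟨ leave w ⟩
      isOdd z + (isOdd (⊝ z) + D)           ≡⟨ +-assoc (isOdd z) _ D ⟨
      isOdd z + isOdd (⊝ z) + D             ≡⟨ cong (_+ D) (isOdd+isOdd[⊝d]≡2 z (adm ∘ (refl ,_))) ⟩
      2 + D                                 ∎
      where open ≡-Reasoning
    4∣2 : 4 ∣ 2
    4∣2 = ∣m+n∣m⇒∣n (subst (4 ∣_) (trans 2m²≡2+D (+-comm 2 D)) (*-pres-∣ 2∣m (n∣m*n m))) 4∣D

  mixed-leave-impossible : ∀ {i j} z → i ≢ j → ¬ Leave (i , j , z)
  mixed-leave-impossible {i} {j} z i≢j leave = from-no (2 ∣? 3) 2∣3
    where
    w : Triple m 4 → ℕ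
    w (i′ , _ , _) = 𝟙[ i ≟ i′ ]
    D : ℕ
    D = ∑ I (w ∘ difference)
    2∣D : 2 ∣ D
    2∣D = ∑-∣ (fin (length C) ⊗ fin 3) λ (a , s) → let c = 𝟙[ i ≟ proj₁ (point a s) ] in
            subst (2 ∣_) (sym (∑-const (fin 2) c)) (m∣m*n c)
    row-sum : Fin m → ℕ
    row-sum i′ = ∑ (fin m ⊗ fin 4) λ (j , d) → 𝟙[ admissible? (i′ , j , d) ]
    row : ∑ T (λ y → w y * 𝟙[ admissible? y ]) ≡ row-sum i
    row = trans (∑-cong (fin m) λ i′ →
                   trans (sym (*-distribˡ-∑ (fin m ⊗ fin 4) 𝟙[ i ≟ i′ ]
                                 λ (j , d) → 𝟙[ admissible? (i′ , j , d) ]))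
                         (*-comm 𝟙[ i ≟ i′ ] (row-sum i′)))
                (∑-select (fin m) row-sum i)
    4m≡3+D : m * 4 ≡ 3 + D
    4m≡3+D = begin
      m * 4                                     ≡⟨ ∑-admissible-row i ⟨
      row-sum i + 2                             ≡⟨ cong (_+ 2) row ⟨
      ∑ T (λ y → w y * 𝟙[ admissible? y ]) + 2  ≡⟨ cong (_+ 2) (leave w) ⟩
      𝟙[ i ≟ i ] + (𝟙[ i ≟ j ] + D) + 2         ≡⟨ cong₂ (λ a b → a + (b + D) + 2) (𝟙-refl i) (𝟙-≢ i≢j) ⟩
      1 + D + 2                                 ≡⟨ +-comm (1 + D) 2 ⟩
      3 + D                                     ∎
      where open ≡-Reasoning
    2∣3 : 2 ∣ 3
    2∣3 = ∣m+n∣m⇒∣n (subst (2 ∣_) (trans 4m≡3+D (+-comm 3 D)) (∣-trans (divides 2 refl) (n∣m*n m)))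
                    2∣D

  leave-impossible : 2 ∣ m → ∀ x → Admissible x → ¬ Leave x
  leave-impossible 2∣m (i , j , z) adm with i ≟ j
  ... | yes refl = pure-leave-impossible 2∣m i z adm
  ... | no i≢j = mixed-leave-impossible z i≢j

  deficit-two-impossible : 2 ∣ m → #admissible m 4 ≢ 2 + length C * 6
  deficit-two-impossible 2∣m #adm≡2+6N =
    let x , adm , leave = leave-exists #adm≡2+6N in leave-impossible 2∣m x adm leave

[r+q*d]/d≡q : ∀ r q d .{{_ : NonZero d}} → r < d → (r + q * d) / d ≡ q
[r+q*d]/d≡q r q d r<d = begin
  (r + q * d) / d    ≡⟨ +-distrib-/ r (q * d) r%d+qd%d<d ⟩
  r / d + q * d / d  ≡⟨ cong₂ _+_ (m<n⇒m/n≡0 r<d) (m*n/n≡m q d) ⟩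
  q                  ∎
  where
  open ≡-Reasoning
  r%d+qd%d<d : r % d + q * d % d < d
  r%d+qd%d<d = subst (_< d) (sym (trans (cong₂ _+_ (m<n⇒m%n≡m r<d) (m*n%n≡0 q d)) (+-identityʳ r))) r<d

J[4+6t,4]≡9+30t+24t² : ∀ t → J (4 + t * 6) 4 ≡ 9 + t * 30 + 24 * (t * t)
J[4+6t,4]≡9+30t+24t² t = begin
  (m * ((m * 4 ∸ 1) / 2)) / 3
    ≡⟨ cong (λ u → (m * ((u ∸ 1) / 2)) / 3) (4m≡2+2[7+12t] t) ⟩
  (m * ((1 + (7 + t * 12) * 2) / 2)) / 3
    ≡⟨ cong (λ u → (m * u) / 3) ([r+q*d]/d≡q 1 (7 + t * 12) 2 (s≤s (s≤s z≤n))) ⟩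
  (m * (7 + t * 12)) / 3
    ≡⟨ cong (_/ 3) (m[7+12t]≡1+3q t) ⟩
  (1 + (9 + t * 30 + 24 * (t * t)) * 3) / 3
    ≡⟨ [r+q*d]/d≡q 1 (9 + t * 30 + 24 * (t * t)) 3 (s≤s (s≤s z≤n)) ⟩
  9 + t * 30 + 24 * (t * t)
    ∎
  where
  open ≡-Reasoning
  m : ℕ
  m = 4 + t * 6
  4m≡2+2[7+12t] : ∀ t → (4 + t * 6) * 4 ≡ 2 + (7 + t * 12) * 2
  4m≡2+2[7+12t] = solve-∀
  m[7+12t]≡1+3q : ∀ t → (4 + t * 6) * (7 + t * 12) ≡ 1 + (9 + t * 30 + 24 * (t * t)) * 3
  m[7+12t]≡1+3q = solve-∀

m%6≡4⇒m≡4+6t : ∀ m → m % 6 ≡ 4 → m ≡ 4 + m / 6 * 6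
m%6≡4⇒m≡4+6t m m%6≡4 = trans (m≡m%n+[m/n]*n m 6) (cong (_+ m / 6 * 6) m%6≡4)

m%6≡4⇒2∣m : ∀ {m} → m % 6 ≡ 4 → 2 ∣ m
m%6≡4⇒2∣m {m} m%6≡4 = divides (2 + m / 6 * 3) (trans (m%6≡4⇒m≡4+6t m m%6≡4) (4+6t≡[2+3t]2 (m / 6)))
  where
  4+6t≡[2+3t]2 : ∀ t → 4 + t * 6 ≡ (2 + t * 3) * 2
  4+6t≡[2+3t]2 = solve-∀

#admissible≡2+6J : ∀ m → m % 6 ≡ 4 → #admissible m 4 ≡ 2 + J m 4 * 6
#admissible≡2+6J m m%6≡4 = +-cancelʳ-≡ (m * 2) _ _ (trans (#admissible[m,4]+2m≡4m² m) (sym 2+6J+2m≡4m²))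
  where
  poly : ∀ t → 2 + (9 + t * 30 + 24 * (t * t)) * 6 + (4 + t * 6) * 2 ≡ (4 + t * 6) * ((4 + t * 6) * 4)
  poly = solve-∀
  2+6J+2m≡4m² : 2 + J m 4 * 6 + m * 2 ≡ m * (m * 4)
  2+6J+2m≡4m² = subst (λ m → 2 + J m 4 * 6 + m * 2 ≡ m * (m * 4)) (sym (m%6≡4⇒m≡4+6t m m%6≡4))
    (trans (cong (λ j → 2 + j * 6 + (4 + m / 6 * 6) * 2) (J[4+6t,4]≡9+30t+24t² (m / 6))) (poly (m / 6)))

*6≤2+*6⇒≤ : ∀ a b → a * 6 ≤ 2 + b * 6 → a ≤ b
*6≤2+*6⇒≤ a b 6a≤2+6b =
  m<1+n⇒m≤n (*-cancelʳ-< 6 a (suc b) (≤-<-trans 6a≤2+6b (+-monoˡ-< (b * 6) (s≤s (s≤s (s≤s z≤n))))))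

lemma3p3 : (m : ℕ) → m % 6 ≡ 4 →
    (C : List (Block m 4)) → IsOOC m 4 3 C → length C ≤ J m 4 ∸ 1
lemma3p3 m m%6≡4 C ooc = <⇒≤pred (≤∧≢⇒< |C|≤J |C|≢J)
  where
  open Differences ooc using (differences-fit)
  open Leaves ooc using (deficit-two-impossible)
  #adm≡2+6J : #admissible m 4 ≡ 2 + J m 4 * 6
  #adm≡2+6J = #admissible≡2+6J m m%6≡4
  |C|≤J : length C ≤ J m 4
  |C|≤J = *6≤2+*6⇒≤ (length C) (J m 4) (subst (length C * 6 ≤_) #adm≡2+6J differences-fit)
  |C|≢J : length C ≢ J m 4
  |C|≢J |C|≡J = deficit-two-impossible (m%6≡4⇒2∣m m%6≡4)
                  (trans #adm≡2+6J (cong (λ n → 2 + n * 6) (sym |C|≡J)))
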